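{- For any $\mathrm{SQCLP}(\mathcal{S},\mathcal{D},\mathcal{C})$-program $\mathcal{P}$, its least model is $\mathcal{M}_{\mathcal{P}}=\{\varphi \mid \varphi \text{ is an observable defined qc-atom and } \mathcal{P}\vdash_{\mathcal{S},\mathcal{D},\mathcal{C}}\varphi\}$.
   Context: Let $\langle \mathcal{S},\mathcal{D},\mathcal{C}\rangle$ be an admissible triple. $\mathcal{C}$ is a constraint domain whose carrier is the set of ground terms, with primitive predicates interpreted as boolean functions; $\mathcal{C}$-constraints are built from primitive atoms and equations $t == s$ by conjunction and existential quantification; $\Pi \models_{\mathcal{C}} \pi$ means every valuation (ground substitution) solving $\Pi$ solves $\pi$. $\mathcal{D}=\langle D,\trianglelefteq,\mathbf{b},\mathbf{t},\circ\rangle$ is a qualification domain: a lattice with bottom $\mathbf{b}$, top $\mathbf{t}$, greatest lower bound $\sqcap$, and attenuation operation $\circ$ (associative, commutative, monotonic, $d\circ\mathbf{t}=d$, $d\circ\mathbf{b}=\mathbf{b}$, $d\circ e\trianglelefteq e$ with $\mathbf{b}\neq d\circ e$ when $d,e\neq\mathbf{b}$, distributive over $\sqcap$), expressible in $\mathcal{C}$. $\mathcal{S}$ is a reflexive ($\mathcal{S}(x,x)=\mathbf{t}$), symmetric, not necessarily transitive $D$-valued proximity relation on variables, basic values, data constructors and predicate symbols (identity on variables; nonbottom only between identical symbols, between basic values, or between constructors, resp. defined predicates, of equal arity), extended to terms by $\mathcal{S}(t,t)=\mathbf{t}$, $\mathcal{S}(X,t)=\mathbf{b}$ for variable $X\neq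 t$, $\mathbf{b}$ for constructors of different arities, and $\mathcal{S}(c(t_1,\dots,t_n),c'(t'_1,\dots,t'_n))=\mathcal{S}(c,c')\sqcap\mathcal{S}(t_1,t'_1)\sqcap\dots\sqcap\mathcal{S}(t_n,t'_n)$. $t\approx_{\lambda,\Pi}s$ (for $\lambda\neq\mathbf{b}$) iff there are $\hat t,\hat s$ with $\Pi\models_{\mathcal{C}} t==\hat t$, $\Pi\models_{\mathcal{C}} s==\hat s$, $\mathcal{S}(\hat t,\hat s)\trianglerighteq\lambda$. A program $\mathcal{P}$ is a set of clauses $p(t_1,\dots,t_n)\leftarrow_{\alpha} B_1\#w_1,\dots,B_m\#w_m$ ($p$ defined predicate, $\alpha\in D\setminus\{\mathbf{b}\}$, $w_j\in(D\setminus\{\mathbf{b}\})\cup\{?\}$; $e\trianglerighteq^? w$ means $e\trianglerighteq w$ if $w\neq ?$, true otherwise). A qc-atom $(A\#d\Leftarrow\Pi)$ is defined, equational or primitive according to $A$, and observable iff $d\neq\mathbf{b}$ and $\Pi$ is satisfiable. $(A\#d\Leftarrow\Pi)$ entails $(A'\#d'\Leftarrow\Pi')$ iff for some substitution $\theta$, $A'=A\theta$, $d'\trianglelefteq d$, $\Pi'\models_{\mathcal{C}}\Pi\theta$. A qc-interpretation is a set of defined observable qc-atoms closed under entailment; $\mathcal{I}\Vdash\varphi$ iff $\varphi$ defined and in $\mathcal{I}$, or $\varphi=((t==s)\#d\Leftarrow\Pi)$ with $t\approx_{d,\Pi}s$, or $\varphi=(\kappa\#d\Leftarrow\Pi)$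 primitive with $\Pi\models_{\mathcal{C}}\kappa$. $(p'(t'_1,\dots,t'_n)\#d\Leftarrow\Pi)$ is an immediate consequence of $\mathcal{I}$ via clause $p(t_1,\dots,t_n)\leftarrow_{\alpha}B_1\#w_1,\dots,B_m\#w_m$ iff for some substitution $\theta$ and $d_0,\dots,d_n,e_1,\dots,e_m\in D\setminus\{\mathbf{b}\}$: $\mathcal{S}(p',p)=d_0$, $t'_i\approx_{d_i,\Pi}t_i\theta$, $\mathcal{I}\Vdash(B_j\theta\#e_j\Leftarrow\Pi)$ with $e_j\trianglerighteq^? w_j$, and $d\trianglelefteq d_0\sqcap d_1\sqcap\dots\sqcap d_n\sqcap(\alpha\circ(e_1\sqcap\dots\sqcap e_m))$ (empty glb $=\mathbf{t}$). $\mathcal{I}$ is a model of $\mathcal{P}$ iff it contains all its defined observable immediate consequences via clauses of $\mathcal{P}$; $\mathcal{M}_{\mathcal{P}}$ denotes the least model of $\mathcal{P}$ under set inclusion (which exists). $\mathcal{P}\vdash_{\mathcal{S},\mathcal{D},\mathcal{C}}\varphi$ means $\varphi$ is derivable in the logic $\mathrm{SQCHL}(\mathcal{S},\mathcal{D},\mathcal{C})$ with three rules: (SQDA) from premises $((t'_i==t_i\theta)\#d_i\Leftarrow\Pi)$ for $i=1..n$ and $(B_j\theta\#e_j\Leftarrow\Pi)$ for $j=1..m$ infer $(p'(t'_1,\dots,t'_n)\#d\Leftarrow\Pi)$, provided $p(t_1,\dots,t_n)\leftarrow_{\alpha}B_1\#w_1,\dots,B_m\#w_m\in\mathcal{P}$,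 $\theta$ a substitution, $\mathcal{S}(p',p)=d_0\neq\mathbf{b}$, $e_j\trianglerighteq^? w_j$ and $d\trianglelefteq d_0\sqcap d_1\sqcap\dots\sqcap d_n\sqcap(\alpha\circ(e_1\sqcap\dots\sqcap e_m))$; (SQEA) infer $((t==s)\#d\Leftarrow\Pi)$ if $t\approx_{d,\Pi}s$; (SQPA) infer $(\kappa\#d\Leftarrow\Pi)$ if $\Pi\models_{\mathcal{C}}\kappa$. -}

module Defs where

open import Level using (Level; 0ℓ) renaming (suc to lsuc)
open import Data.Nat using (ℕ; zero; suc; _≟_)
open import Data.Bool using (Bool; true; false)
open import Data.Empty using (⊥)
open import Data.Unit using (⊤; tt)
open import Data.Maybe using (Maybe; just; nothing)
open import Data.Product using (Σ; ∃; ∃-syntax; _×_; _,_; proj₁; proj₂)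
open import Data.Sum using (_⊎_; inj₁; inj₂)
open import Data.List using (List; []; _∷_; foldr)
open import Data.List.Membership.Propositional using (_∈_)
open import Data.Vec using (Vec; []; _∷_; toList)
open import Function.Bundles using (_⇔_)
open import Relation.Nullary using (¬_; yes; no)
open import Relation.Binary using (Rel)
open import Relation.Binary.PropositionalEquality using (_≡_; _≢_; refl)
open import Relation.Binary.Definitions using (Minimum; Maximum)
import Relation.Binary.Lattice.Structures as LS

-- Signature + constraint domain C
-- Carrier of C = ground terms; primitive predicates interpreted as
-- boolean functions on ground terms.

record Signature : Set₁ where
  field
    BVal  : Set
    Con   : ℕ → Set
    PPred : ℕ → Set
    DPred : ℕ → Set

module Syntax (sig : Signature) where
  open Signature sig

  data Term (V : Set) : Set where
    var : V → Term V
    val : BVal → Term V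
    con : ∀ {n} → Con n → Vec (Term V) n → Term V

  GTerm : Set
  GTerm = Term ⊥

  Subst : Set
  Subst = ℕ → Term ℕ

  Valuation : Set
  Valuation = ℕ → GTerm

  mutual
    _⟪_⟫ : ∀ {V W} → Term V → (V → Term W) → Term W
    var x ⟪ σ ⟫ = σ x
    val u ⟪ σ ⟫ = val u
    con c ts ⟪ σ ⟫ = con c (ts ⟪ σ ⟫ᵛ)

    _⟪_⟫ᵛ : ∀ {V W n} → Vec (Term V) n → (V → Term W) → Vec (Term W) n
    [] ⟪ σ ⟫ᵛ = []
    (t ∷ ts) ⟪ σ ⟫ᵛ = (t ⟪ σ ⟫) ∷ (ts ⟪ σ ⟫ᵛ)

  _⨾_ : ∀ {W} → Subst → (ℕ → Term W) → (ℕ → Term W)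
  (θ ⨾ η) x = θ x ⟪ η ⟫

  data Constraint : Set where
    prim : ∀ {n} → PPred n → Vec (Term ℕ) n → Constraint
    _==_ : Term ℕ → Term ℕ → Constraint
    _∧_  : Constraint → Constraint → Constraint
    ex   : ℕ → Constraint → Constraint

  CSet : Set
  CSet = List Constraint

  update : Valuation → ℕ → GTerm → Valuation
  update η x g y with y ≟ x
  ... | yes _ = g
  ... | no  _ = η y

module ConstraintDomain (sig : Signature) where
  open Signature sig
  open Syntax sig

  PrimInterp : Set
  PrimInterp = ∀ {n} → PPred n → Vec GTerm n → Bool

  module Semantics (⟦_⟧ : PrimInterp) where
    Sol : Valuation → Constraint → Set
    Sol η (prim r ts) = ⟦ r ⟧ (ts ⟪ η ⟫ᵛ) ≡ true
    Sol η (t == s)    = t ⟪ η ⟫ ≡ s ⟪ η ⟫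
    Sol η (π ∧ π')    = Sol η π × Sol η π'
    Sol η (ex x π)    = ∃[ g ] Sol (update η x g) π

    Sols : Valuation → CSet → Set
    Sols η Π = ∀ π → π ∈ Π → Sol η π

    Satisfiable : CSet → Set
    Satisfiable Π = ∃[ η ] Sols η Π

    -- Π ⊨ π θ : every valuation solving Π solves the instance π θ
    -- (instance taken semantically, i.e. capture-avoiding)
    _⊨[_]_ : CSet → Subst → Constraint → Set
    Π ⊨[ θ ] π = ∀ η → Sols η Π → Sol (θ ⨾ η) π

    _⊨_ : CSet → Constraint → Set
    Π ⊨ π = Π ⊨[ var ] π

    _⊨ˢ[_]_ : CSet → Subst → CSet → Set
    Π' ⊨ˢ[ θ ] Π = ∀ π → π ∈ Π → Π' ⊨[ θ ] π

record ConstraintDom (sig : Signature) : Set where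
  field
    ⟦_⟧ : ConstraintDomain.PrimInterp sig

record QDom (sig : Signature) (C : ConstraintDom sig) : Set₁ where
  open Syntax sig
  open ConstraintDomain sig
  open Semantics (ConstraintDom.⟦_⟧ C)
  infixr 7 _∘_
  field
    D     : Set
    _⊴_   : Rel D 0ℓ
    b t   : D
    _⊔_   : D → D → D
    _⊓_   : D → D → D
    _∘_   : D → D → D
    isLattice : LS.IsLattice {A = D} _≡_ _⊴_ _⊔_ _⊓_
    b-min : Minimum _⊴_ b
    t-max : Maximum _⊴_ t
    ∘-assoc   : ∀ x y z → (x ∘ y) ∘ z ≡ x ∘ (y ∘ z)
    ∘-comm    : ∀ x y → x ∘ y ≡ y ∘ x
    ∘-mono    : ∀ {x x' y y'} → x ⊴ x' → y ⊴ y' → (x ∘ y) ⊴ (x' ∘ y')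
    ∘-identʳ  : ∀ x → x ∘ t ≡ x
    ∘-zeroʳ   : ∀ x → x ∘ b ≡ b
    ∘-⊴       : ∀ x y → (x ∘ y) ⊴ y
    ∘-nonb    : ∀ x y → x ≢ b → y ≢ b → (x ∘ y) ≢ b
    ∘-distrib-⊓ : ∀ x y z → x ∘ (y ⊓ z) ≡ (x ∘ y) ⊓ (x ∘ z)
    -- expressibility in C: injective encoding ι of D∖{b} into C-values
    -- and constraints qVal(X₀), qBound(X₀,X₁,X₂) (variables 0,1,2)
    ι      : D → GTerm
    ι-inj  : ∀ x y → x ≢ b → y ≢ b → ι x ≡ ι y → x ≡ y
    qVal   : Constraint
    qBound : Constraint
    qVal-spec   : ∀ η → Sol η qVal ⇔ (∃[ x ] (x ≢ b × η 0 ≡ ι x))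
    qBound-spec : ∀ η x y z → x ≢ b → y ≢ b → z ≢ b →
                  η 0 ≡ ι x → η 1 ≡ ι y → η 2 ≡ ι z →
                  Sol η qBound ⇔ (x ⊴ (y ∘ z))

module Symbols (sig : Signature) where
  open Signature sig
  data Sym : Set where
    svar : ℕ → Sym
    sval : BVal → Sym
    scon : ∀ {n} → Con n → Sym
    sprim : ∀ {n} → PPred n → Sym
    sdef : ∀ {n} → DPred n → Sym

  data Compatible : Sym → Sym → Set where
    same    : ∀ {s} → Compatible s s
    vals    : ∀ {u u'} → Compatible (sval u) (sval u')
    cons    : ∀ {n} {c c' : Con n} → Compatible (scon c) (scon c')
    defs    : ∀ {n} {p p' : DPred n} → Compatible (sdef p) (sdef p')

record Proximity (sig : Signature) (C : ConstraintDom sig) (Q : QDom sig C) : Set where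
  open Symbols sig
  open QDom Q
  field
    S      : Sym → Sym → D
    S-refl : ∀ x → S x x ≡ t
    S-sym  : ∀ x y → S x y ≡ S y x
    S-var  : ∀ x y → x ≢ y → S (svar x) (svar y) ≡ b
    S-nonb : ∀ x y → S x y ≢ b → Compatible x y

module SQCLP (sig : Signature) (C : ConstraintDom sig) (Q : QDom sig C)
             (Prox : Proximity sig C Q) where
  open Signature sig
  open Syntax sig public
  open ConstraintDomain sig
  open Semantics (ConstraintDom.⟦_⟧ C) public
  open QDom Q public
  open Symbols sig public
  open Proximity Prox public

  mutual
    Sᵗ : Term ℕ → Term ℕ → D
    Sᵗ (var x) (var y) with x ≟ y
    ... | yes _ = t
    ... | no  _ = b
    Sᵗ (var x) (val _)   = b
    Sᵗ (var x) (con _ _) = b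
    Sᵗ (val _) (var _)   = b
    Sᵗ (con _ _) (var _) = b
    Sᵗ (val u) (val u')  = S (sval u) (sval u')
    Sᵗ (val u) (con _ _) = b
    Sᵗ (con _ _) (val _) = b
    Sᵗ (con {n} c ts) (con {m} c' ts') with n ≟ m
    ... | yes refl = S (scon c) (scon c') ⊓ Sᵛ ts ts'
    ... | no  _    = b

    Sᵛ : ∀ {n} → Vec (Term ℕ) n → Vec (Term ℕ) n → D
    Sᵛ [] [] = t
    Sᵛ (x ∷ xs) (y ∷ ys) = Sᵗ x y ⊓ Sᵛ xs ys

  Approx : D → CSet → Term ℕ → Term ℕ → Set
  Approx λ' Π t' s = λ' ≢ b × ∃[ t̂ ] ∃[ ŝ ]
    (Π ⊨ (t' == t̂) × Π ⊨ (s == ŝ) × λ' ⊴ Sᵗ t̂ ŝ)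

  data Atom : Set where
    def  : ∀ {n} → DPred n → Vec (Term ℕ) n → Atom
    primA : ∀ {n} → PPred n → Vec (Term ℕ) n → Atom
    eqn  : Term ℕ → Term ℕ → Atom

  _⟪_⟫ᵃ : Atom → Subst → Atom
  def p ts ⟪ θ ⟫ᵃ = def p (ts ⟪ θ ⟫ᵛ)
  primA r ts ⟪ θ ⟫ᵃ = primA r (ts ⟪ θ ⟫ᵛ)
  eqn t' s ⟪ θ ⟫ᵃ = eqn (t' ⟪ θ ⟫) (s ⟪ θ ⟫)

  record QCAtom : Set where
    constructor _#_⇐_
    field
      atom : Atom
      qual : D
      cstr : CSet

  IsDefined : Atom → Set
  IsDefined (def _ _) = ⊤
  IsDefined _ = ⊥

  Defined : QCAtom → Set
  Defined (A # _ ⇐ _) = IsDefined A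

  Observable : QCAtom → Set
  Observable (_ # d ⇐ Π) = d ≢ b × Satisfiable Π

  Entails : QCAtom → QCAtom → Set
  Entails (A # d ⇐ Π) (A' # d' ⇐ Π') =
    ∃[ θ ] (A' ≡ A ⟪ θ ⟫ᵃ × d' ⊴ d × Π' ⊨ˢ[ θ ] Π)

  Interp : Set₁
  Interp = QCAtom → Set

  IsInterp : Interp → Set
  IsInterp I =
    (∀ φ → I φ → Defined φ × Observable φ) ×
    (∀ φ ψ → I φ → Entails φ ψ → Observable ψ → I ψ)

  _⊩_ : Interp → QCAtom → Set
  I ⊩ (def p ts # d ⇐ Π) = I (def p ts # d ⇐ Π)
  I ⊩ (primA r ts # d ⇐ Π) = Π ⊨ prim r ts
  I ⊩ (eqn t' s # d ⇐ Π) = Approx d Π t' s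

  -- weights: nothing = ?, just w
  _⊵?_ : D → Maybe D → Set
  e ⊵? nothing = ⊤
  e ⊵? just w  = w ⊴ e

  glb : List D → D
  glb = foldr _⊓_ t

  record Clause : Set where
    constructor clause
    field
      {arity} : ℕ
      head    : DPred arity
      args    : Vec (Term ℕ) arity
      α       : D
      α-nonb  : α ≢ b
      body    : List (Atom × Maybe D)
      w-nonb  : ∀ w → (∃[ B ] ((B , just w) ∈ body)) → w ≢ b

  Program : Set₁
  Program = Clause → Set

  data All₂ {A B : Set} (R : A → B → Set) : List A → List B → Set where
    []  : All₂ R [] []
    _∷_ : ∀ {x y xs ys} → R x y → All₂ R xs ys → All₂ R (x ∷ xs) (y ∷ ys)

  data All₃ {A B E : Set} (R : A → B → E → Set) :
       List A → List B → List E → Set where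
    []  : All₃ R [] [] []
    _∷_ : ∀ {x y z xs ys zs} → R x y z → All₃ R xs ys zs →
          All₃ R (x ∷ xs) (y ∷ ys) (z ∷ zs)

  NonB : D → Set
  NonB d = d ≢ b

  ImmCons : Interp → Clause → QCAtom → Set
  ImmCons I (clause p ts α _ body _) (def p' ts' # d ⇐ Π) =
    ∃[ θ ] ∃[ d₀ ] ∃[ ds ] ∃[ es ]
      ( S (sdef p') (sdef p) ≡ d₀ × d₀ ≢ b
      × All₃ (λ t'ᵢ tᵢ dᵢ → dᵢ ≢ b × Approx dᵢ Π t'ᵢ (tᵢ ⟪ θ ⟫))
             (toList ts') (toList ts) ds
      × All₂ (λ Bw eⱼ → eⱼ ≢ b × I ⊩ ((proj₁ Bw ⟪ θ ⟫ᵃ) # eⱼ ⇐ Π)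
                        × eⱼ ⊵? proj₂ Bw)
             body es
      × d ⊴ (d₀ ⊓ (glb ds ⊓ (α ∘ glb es))))
  ImmCons I _ (primA _ _ # _ ⇐ _) = ⊥
  ImmCons I _ (eqn _ _ # _ ⇐ _) = ⊥

  IsModel : Program → Interp → Set
  IsModel P I = ∀ C → P C → ∀ φ → ImmCons I C φ → Observable φ → I φ

  IsLeastModel : Program → Interp → Set₁
  IsLeastModel P M =
    IsInterp M × IsModel P M ×
    (∀ (I : Interp) → IsInterp I → IsModel P I → ∀ φ → M φ → I φ)

  data _⊢_ (P : Program) : QCAtom → Set where
    SQDA : ∀ {n' n} {p' : DPred n'} {ts' : Vec (Term ℕ) n'}
             {p : DPred n} {ts : Vec (Term ℕ) n} {α α-nonb body w-nonb}
             (θ : Subst) {d₀ d : D} {Π : CSet} (ds es : List D) →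
           P (clause p ts α α-nonb body w-nonb) →
           S (sdef p') (sdef p) ≡ d₀ → d₀ ≢ b →
           All₃ (λ t'ᵢ tᵢ dᵢ → P ⊢ (eqn t'ᵢ (tᵢ ⟪ θ ⟫) # dᵢ ⇐ Π))
                (toList ts') (toList ts) ds →
           All₂ (λ Bw eⱼ → P ⊢ ((proj₁ Bw ⟪ θ ⟫ᵃ) # eⱼ ⇐ Π)
                           × eⱼ ⊵? proj₂ Bw)
                body es →
           d ⊴ (d₀ ⊓ (glb ds ⊓ (α ∘ glb es))) →
           P ⊢ (def p' ts' # d ⇐ Π)
    SQEA : ∀ {t' s d Π} → Approx d Π t' s → P ⊢ (eqn t' s # d ⇐ Π)
    SQPA : ∀ {n} {r : PPred n} {ts d Π} → Π ⊨ prim r ts →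
           P ⊢ (primA r ts # d ⇐ Π)

  DerivableObs : Program → Interp
  DerivableObs P φ = Defined φ × Observable φ × P ⊢ φ

-- A derivation is an immediate-consequence witness whose premises are
-- again derivations, so the observable derivable atoms form a model; they
-- are closed under entailment because derivations can be instantiated
-- (proximity of terms only grows under substitution) and their qualification
-- lowered.  Conversely, induction on derivations puts every observable
-- derivable atom into any model: a non-bottom conclusion forces non-bottom
-- body qualifications, since attenuation by b yields b.
module Submission where

open import Defs
open import Data.Nat using (ℕ; _≟_)
open import Data.Empty using (⊥-elim)
open import Data.Unit using (tt)
open import Data.Maybe using (Maybe)
open import Data.Product using (_×_; _,_; proj₁; proj₂)
open import Data.List using (List; []; _∷_)
open import Data.Vec using (Vec; []; _∷_; toList)
open import Relation.Nullary using (yes; no)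
open import Relation.Binary.PropositionalEquality
  using (_≡_; _≢_; refl; sym; trans; cong; cong₂; subst)
import Relation.Binary.Lattice.Structures as LS

module Framework (sig : Signature) (C : ConstraintDom sig) (Q : QDom sig C)
                 (Prox : Proximity sig C Q) where
  open SQCLP sig C Q Prox
  open LS.IsLattice isLattice
    using (antisym; reflexive; ∧-greatest; x∧y≤x; x∧y≤y)
    renaming (refl to ⊴-refl; trans to ⊴-trans)

  All₂-map : ∀ {A B : Set} {R R' : A → B → Set} →
             (∀ {x y} → R x y → R' x y) →
             ∀ {xs ys} → All₂ R xs ys → All₂ R' xs ys
  All₂-map f [] = []
  All₂-map f (r ∷ rs) = f r ∷ All₂-map f rs

  All₃-map : ∀ {A B E : Set} {R R' : A → B → E → Set} →
             (∀ {x y z} → R x y z → R' x y z) →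
             ∀ {xs ys zs} → All₃ R xs ys zs → All₃ R' xs ys zs
  All₃-map f [] = []
  All₃-map f (r ∷ rs) = f r ∷ All₃-map f rs

  ⊴-nonb : ∀ {x y} → x ⊴ y → x ≢ b → y ≢ b
  ⊴-nonb {x} x⊴y x≢b y≡b = x≢b (antisym (subst (x ⊴_) y≡b x⊴y) (b-min x))

  ∘-nonbʳ : ∀ x y → x ∘ y ≢ b → y ≢ b
  ∘-nonbʳ x y x∘y≢b y≡b = x∘y≢b (trans (cong (x ∘_) y≡b) (∘-zeroʳ x))

  ⊓-nonbˡ : ∀ x y → x ⊓ y ≢ b → x ≢ b
  ⊓-nonbˡ x y = ⊴-nonb (x∧y≤x x y)

  ⊓-nonbʳ : ∀ x y → x ⊓ y ≢ b → y ≢ b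
  ⊓-nonbʳ x y = ⊴-nonb (x∧y≤y x y)

  mutual
    ⟪⟫-⨾ : ∀ {W} (u : Term ℕ) (θ : Subst) (η : ℕ → Term W) →
           u ⟪ θ ⨾ η ⟫ ≡ u ⟪ θ ⟫ ⟪ η ⟫
    ⟪⟫-⨾ (var x) θ η = refl
    ⟪⟫-⨾ (val u) θ η = refl
    ⟪⟫-⨾ (con c us) θ η = cong (con c) (⟪⟫ᵛ-⨾ us θ η)

    ⟪⟫ᵛ-⨾ : ∀ {W n} (us : Vec (Term ℕ) n) (θ : Subst) (η : ℕ → Term W) →
            us ⟪ θ ⨾ η ⟫ᵛ ≡ us ⟪ θ ⟫ᵛ ⟪ η ⟫ᵛ
    ⟪⟫ᵛ-⨾ [] θ η = refl
    ⟪⟫ᵛ-⨾ (u ∷ us) θ η = cong₂ _∷_ (⟪⟫-⨾ u θ η) (⟪⟫ᵛ-⨾ us θ η)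

  ⟪⟫ᵃ-⨾ : ∀ (A : Atom) (θ σ : Subst) → A ⟪ θ ⨾ σ ⟫ᵃ ≡ A ⟪ θ ⟫ᵃ ⟪ σ ⟫ᵃ
  ⟪⟫ᵃ-⨾ (def p us) θ σ = cong (def p) (⟪⟫ᵛ-⨾ us θ σ)
  ⟪⟫ᵃ-⨾ (primA r us) θ σ = cong (primA r) (⟪⟫ᵛ-⨾ us θ σ)
  ⟪⟫ᵃ-⨾ (eqn u v) θ σ = cong₂ eqn (⟪⟫-⨾ u θ σ) (⟪⟫-⨾ v θ σ)

  mutual
    Sᵗ-refl : ∀ u → t ⊴ Sᵗ u u
    Sᵗ-refl (var x) with x ≟ x
    ... | yes _ = ⊴-refl
    ... | no x≢x = ⊥-elim (x≢x refl)
    Sᵗ-refl (val u) = reflexive (sym (S-refl _))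
    Sᵗ-refl (con {n} c us) with n ≟ n
    ... | yes refl = ∧-greatest (reflexive (sym (S-refl _))) (Sᵛ-refl us)
    ... | no n≢n = ⊥-elim (n≢n refl)

    Sᵛ-refl : ∀ {n} (us : Vec (Term ℕ) n) → t ⊴ Sᵛ us us
    Sᵛ-refl [] = ⊴-refl
    Sᵛ-refl (u ∷ us) = ∧-greatest (Sᵗ-refl u) (Sᵛ-refl us)

  mutual
    Sᵗ-⊴-⟪⟫ : ∀ u v (σ : Subst) → Sᵗ u v ⊴ Sᵗ (u ⟪ σ ⟫) (v ⟪ σ ⟫)
    Sᵗ-⊴-⟪⟫ (var x) (var y) σ with x ≟ y
    ... | yes refl = Sᵗ-refl (σ x)
    ... | no _ = b-min _
    Sᵗ-⊴-⟪⟫ (var x) (val _) σ = b-min _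
    Sᵗ-⊴-⟪⟫ (var x) (con _ _) σ = b-min _
    Sᵗ-⊴-⟪⟫ (val _) (var _) σ = b-min _
    Sᵗ-⊴-⟪⟫ (con _ _) (var _) σ = b-min _
    Sᵗ-⊴-⟪⟫ (val _) (val _) σ = ⊴-refl
    Sᵗ-⊴-⟪⟫ (val _) (con _ _) σ = ⊴-refl
    Sᵗ-⊴-⟪⟫ (con _ _) (val _) σ = ⊴-refl
    Sᵗ-⊴-⟪⟫ (con {n} c us) (con {m} c' vs) σ with n ≟ m
    ... | yes refl = ∧-greatest (x∧y≤x _ _) (⊴-trans (x∧y≤y _ _) (Sᵛ-⊴-⟪⟫ us vs σ))
    ... | no _ = ⊴-refl

    Sᵛ-⊴-⟪⟫ : ∀ {n} (us vs : Vec (Term ℕ) n) (σ : Subst) →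
              Sᵛ us vs ⊴ Sᵛ (us ⟪ σ ⟫ᵛ) (vs ⟪ σ ⟫ᵛ)
    Sᵛ-⊴-⟪⟫ [] [] σ = ⊴-refl
    Sᵛ-⊴-⟪⟫ (u ∷ us) (v ∷ vs) σ =
      ∧-greatest (⊴-trans (x∧y≤x _ _) (Sᵗ-⊴-⟪⟫ u v σ))
                 (⊴-trans (x∧y≤y _ _) (Sᵛ-⊴-⟪⟫ us vs σ))

  module _ {Π Π' : CSet} {σ : Subst} (Π'⊨Πσ : Π' ⊨ˢ[ σ ] Π) where

    solves-instance : ∀ η → Sols η Π' → Sols (σ ⨾ η) Π
    solves-instance η sols π π∈Π = Π'⊨Πσ π π∈Π η sols

    ⊨-==-⟪⟫ : ∀ u v → Π ⊨ (u == v) → Π' ⊨ ((u ⟪ σ ⟫) == (v ⟪ σ ⟫))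
    ⊨-==-⟪⟫ u v Π⊨u=v η sols =
      trans (sym (⟪⟫-⨾ u σ η))
            (trans (Π⊨u=v (σ ⨾ η) (solves-instance η sols)) (⟪⟫-⨾ v σ η))

    ⊨-prim-⟪⟫ : ∀ {n} (r : Signature.PPred sig n) us →
                Π ⊨ prim r us → Π' ⊨ prim r (us ⟪ σ ⟫ᵛ)
    ⊨-prim-⟪⟫ r us Π⊨r η sols =
      trans (cong (ConstraintDom.⟦_⟧ C r) (sym (⟪⟫ᵛ-⨾ us σ η)))
            (Π⊨r (σ ⨾ η) (solves-instance η sols))

    Approx-⟪⟫ : ∀ {d} u v → Approx d Π u v → Approx d Π' (u ⟪ σ ⟫) (v ⟪ σ ⟫)
    Approx-⟪⟫ u v (d≢b , û , v̂ , Π⊨u=û , Π⊨v=v̂ , d⊴Sûv̂) =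
      d≢b , û ⟪ σ ⟫ , v̂ ⟪ σ ⟫ ,
      ⊨-==-⟪⟫ u û Π⊨u=û , ⊨-==-⟪⟫ v v̂ Π⊨v=v̂ , ⊴-trans d⊴Sûv̂ (Sᵗ-⊴-⟪⟫ û v̂ σ)

  module _ (P : Program) where

    ⊢eqn⇒Approx : ∀ {u v d Π} → P ⊢ (eqn u v # d ⇐ Π) → Approx d Π u v
    ⊢eqn⇒Approx (SQEA ap) = ap

    mutual
      ⊢-⟪⟫ : ∀ {A d Π Π'} (σ : Subst) → Π' ⊨ˢ[ σ ] Π →
             P ⊢ (A # d ⇐ Π) → P ⊢ ((A ⟪ σ ⟫ᵃ) # d ⇐ Π')
      ⊢-⟪⟫ σ Π'⊨Πσ (SQDA {ts' = ts'} {ts = ts} θ ds es P∋cl S≡d₀ d₀≢b args body d⊴) =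
        SQDA (θ ⨾ σ) ds es P∋cl S≡d₀ d₀≢b
             (args-⟪⟫ σ Π'⊨Πσ θ ts' ts args) (body-⟪⟫ σ Π'⊨Πσ θ body) d⊴
      ⊢-⟪⟫ σ Π'⊨Πσ (SQEA {t' = u} {s = v} ap) = SQEA (Approx-⟪⟫ Π'⊨Πσ u v ap)
      ⊢-⟪⟫ σ Π'⊨Πσ (SQPA {r = r} {ts = us} Π⊨r) = SQPA (⊨-prim-⟪⟫ Π'⊨Πσ r us Π⊨r)

      args-⟪⟫ : ∀ {n' n Π Π' ds} (σ : Subst) → Π' ⊨ˢ[ σ ] Π → ∀ θ
                (ts' : Vec (Term ℕ) n') (ts : Vec (Term ℕ) n) →
                All₃ (λ u' u dᵢ → P ⊢ (eqn u' (u ⟪ θ ⟫) # dᵢ ⇐ Π))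
                     (toList ts') (toList ts) ds →
                All₃ (λ u' u dᵢ → P ⊢ (eqn u' (u ⟪ θ ⨾ σ ⟫) # dᵢ ⇐ Π'))
                     (toList (ts' ⟪ σ ⟫ᵛ)) (toList ts) ds
      args-⟪⟫ σ Π'⊨Πσ θ [] [] [] = []
      args-⟪⟫ {Π' = Π'} σ Π'⊨Πσ θ (u' ∷ ts') (u ∷ ts) (⊢u'≈u ∷ rest) =
        subst (λ v → P ⊢ (eqn (u' ⟪ σ ⟫) v # _ ⇐ Π')) (sym (⟪⟫-⨾ u θ σ))
              (⊢-⟪⟫ σ Π'⊨Πσ ⊢u'≈u)
        ∷ args-⟪⟫ σ Π'⊨Πσ θ ts' ts rest

      body-⟪⟫ : ∀ {Π Π'} {body : List (Atom × Maybe D)} {es} (σ : Subst) →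
                Π' ⊨ˢ[ σ ] Π → ∀ θ →
                All₂ (λ Bw e → P ⊢ ((proj₁ Bw ⟪ θ ⟫ᵃ) # e ⇐ Π) × e ⊵? proj₂ Bw) body es →
                All₂ (λ Bw e → P ⊢ ((proj₁ Bw ⟪ θ ⨾ σ ⟫ᵃ) # e ⇐ Π') × e ⊵? proj₂ Bw) body es
      body-⟪⟫ σ Π'⊨Πσ θ [] = []
      body-⟪⟫ {Π' = Π'} {(B , _) ∷ _} {e ∷ _} σ Π'⊨Πσ θ ((⊢Bθ , e⊵w) ∷ rest) =
        (subst (λ A → P ⊢ (A # e ⇐ Π')) (sym (⟪⟫ᵃ-⨾ B θ σ)) (⊢-⟪⟫ σ Π'⊨Πσ ⊢Bθ) , e⊵w)
        ∷ body-⟪⟫ σ Π'⊨Πσ θ rest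

    ⊢-weaken : ∀ {n} {p : Signature.DPred sig n} {us d d' Π} → d' ⊴ d →
               P ⊢ (def p us # d ⇐ Π) → P ⊢ (def p us # d' ⇐ Π)
    ⊢-weaken d'⊴d (SQDA θ ds es P∋cl S≡d₀ d₀≢b args body d⊴) =
      SQDA θ ds es P∋cl S≡d₀ d₀≢b args body (⊴-trans d'⊴d d⊴)

    DerivableObs-isInterp : IsInterp (DerivableObs P)
    DerivableObs-isInterp = (λ _ (defined , observable , _) → defined , observable) , closed
      where
      closed : ∀ φ ψ → DerivableObs P φ → Entails φ ψ → Observable ψ → DerivableObs P ψ
      closed (def p us # d ⇐ Π) (_ # d' ⇐ Π') (_ , _ , ⊢φ) (θ , refl , d'⊴d , Π'⊨Πθ) obs =
        tt , obs , ⊢-weaken d'⊴d (⊢-⟪⟫ θ Π'⊨Πθ ⊢φ)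

    ⊩⇒⊢ : ∀ A {d Π} → DerivableObs P ⊩ (A # d ⇐ Π) → P ⊢ (A # d ⇐ Π)
    ⊩⇒⊢ (def p us) (_ , _ , ⊢A) = ⊢A
    ⊩⇒⊢ (primA r us) Π⊨r = SQPA Π⊨r
    ⊩⇒⊢ (eqn u v) ap = SQEA ap

    DerivableObs-isModel : IsModel P (DerivableObs P)
    DerivableObs-isModel (clause _ _ _ _ _ _) P∋cl (def p' ts' # d ⇐ Π)
                         (θ , d₀ , ds , es , S≡d₀ , d₀≢b , args , ⊩body , d⊴) obs =
      tt , obs , SQDA θ ds es P∋cl S≡d₀ d₀≢b
                      (All₃-map (λ (_ , ap) → SQEA ap) args)
                      (All₂-map (λ {Bw} (_ , ⊩B , e⊵w) → ⊩⇒⊢ (proj₁ Bw ⟪ θ ⟫ᵃ) ⊩B , e⊵w) ⊩body)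
                      d⊴

    module _ (I : Interp) (I-model : IsModel P I) where

      mutual
        ⊢⇒⊩ : ∀ {A d Π} → d ≢ b → Satisfiable Π → P ⊢ (A # d ⇐ Π) → I ⊩ (A # d ⇐ Π)
        ⊢⇒⊩ {def p' ts'} {d} {Π} d≢b sat
            (SQDA {p = p} {ts = ts} {α} {α≢b} {body} {w≢b} θ ds es P∋cl S≡d₀ d₀≢b args ⊢body d⊴) =
          I-model (clause p ts α α≢b body w≢b) P∋cl (def p' ts' # d ⇐ Π)
            ( θ , _ , ds , es , S≡d₀ , d₀≢b
            , All₃-map (λ ⊢eq → let ap = ⊢eqn⇒Approx ⊢eq in proj₁ ap , ap) args
            , body-⊩ sat glb-es≢b ⊢body , d⊴ )
            (d≢b , sat)
          where
          glb-es≢b : glb es ≢ b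
          glb-es≢b = ∘-nonbʳ α (glb es) (⊓-nonbʳ _ _ (⊓-nonbʳ _ _ (⊴-nonb d⊴ d≢b)))
        ⊢⇒⊩ d≢b sat (SQEA ap) = ap
        ⊢⇒⊩ d≢b sat (SQPA Π⊨r) = Π⊨r

        body-⊩ : ∀ {Π θ} {body : List (Atom × Maybe D)} {es} → Satisfiable Π → glb es ≢ b →
                 All₂ (λ Bw e → P ⊢ ((proj₁ Bw ⟪ θ ⟫ᵃ) # e ⇐ Π) × e ⊵? proj₂ Bw) body es →
                 All₂ (λ Bw e → e ≢ b × I ⊩ ((proj₁ Bw ⟪ θ ⟫ᵃ) # e ⇐ Π) × e ⊵? proj₂ Bw) body es
        body-⊩ sat glb≢b [] = []
        body-⊩ sat glb≢b ((⊢B , e⊵w) ∷ rest) =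
          (e≢b , ⊢⇒⊩ e≢b sat ⊢B , e⊵w) ∷ body-⊩ sat (⊓-nonbʳ _ _ glb≢b) rest
          where e≢b = ⊓-nonbˡ _ _ glb≢b

      DerivableObs-⊆ : ∀ φ → DerivableObs P φ → I φ
      DerivableObs-⊆ (def p us # d ⇐ Π) (_ , (d≢b , sat) , ⊢φ) = ⊢⇒⊩ d≢b sat ⊢φ

theorem2 : (sig : Signature) (C : ConstraintDom sig) (Q : QDom sig C)
           (Prox : Proximity sig C Q) (P : SQCLP.Program sig C Q Prox) →
           SQCLP.IsLeastModel sig C Q Prox P (SQCLP.DerivableObs sig C Q Prox P)
theorem2 sig C Q Prox P =
  DerivableObs-isInterp P , DerivableObs-isModel P ,
  λ I _ I-model → DerivableObs-⊆ P I I-model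
  where open Framework sig C Q Prox
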